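{- Let $H$ be a finite abelian group with a fixed enumeration $H = \{h_0 = 0_H, h_1, \dots, h_{t-1}\}$, and let $\bm{\lambda} = (\lambda_0,\dots,\lambda_{t-1})$ be a sequence of nonnegative integers. Suppose that for infinitely many primes $p$, every non-zero sum subset of $(\mathbb{Z}_p \times H) \setminus \{0_{\mathbb{Z}_p\times H}\}$ of type $\bm{\lambda}$ is sequenceable. Then every non-zero sum subset of $(\mathbb{Z} \times H)\setminus\{0_{\mathbb{Z}\times H}\}$ of type $\bm{\lambda}$ is sequenceable.
   Context: Let $A$ be an abelian group and $S \subseteq A\setminus\{0\}$ a finite subset of size $k$. For an ordering $(x_1,\dots,x_k)$ of $S$, its partial sums are $y_0 = 0$ and $y_i = x_1+\dots+x_i$. $S$ is sequenceable if some ordering has partial sums $y_0,\dots,y_k$ pairwise distinct, except that $y_k = y_0 = 0$ is permitted. $S$ is non-zero sum if $\sum_{s\in S} s \neq 0$. For a group of the form $X \times H$ with $H$ enumerated as $\{h_0=0_H,h_1,\dots,h_{t-1}\}$, the type of a finite subset $S$ is $\bm{\lambda}=(\lambda_0,\dots,\lambda_{t-1})$ where $\lambda_i$ is the number of elements $s\in S$ whose projection to $H$ equals $h_i$. -}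

module Defs where

open import Level using (Level)
open import Data.Nat using (ℕ; zero; suc; _+_; _<_; _%_)
open import Data.Nat.DivMod using (m%n<n)
open import Data.Integer as ℤ using (ℤ)
open import Data.Fin as Fin using (Fin; toℕ; fromℕ<)
open import Data.Product using (Σ; ∃; _×_; _,_; proj₁; proj₂)
open import Data.List using (List; []; _∷_; length; lookup; filter; foldr)
open import Data.List.Relation.Unary.All using (All)
open import Data.List.Relation.Unary.Unique.Propositional using (Unique)
open import Data.List.Relation.Binary.Permutation.Propositional using (_↭_)
open import Relation.Binary.PropositionalEquality using (_≡_; _≢_)
open import Algebra.Structures using (IsAbelianGroup)

private variable a : Level

-- A finite abelian group H of order suc t, with its fixed enumeration
-- h_0 = 0_H, h_1, ..., h_t given by the elements of Fin (suc t):
-- h_i is the element with index i, and h_0 = Fin.zero is the identity.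

record FinAbGroup (t : ℕ) : Set where
  field
    _∙_  : Fin (suc t) → Fin (suc t) → Fin (suc t)
    inv  : Fin (suc t) → Fin (suc t)
    isAbelianGroup : IsAbelianGroup _≡_ _∙_ Fin.zero inv

partialSums : {G : Set a} → (G → G → G) → G → List G → List G
partialSums _+'_ y []       = y ∷ []
partialSums _+'_ y (x ∷ xs) = y ∷ partialSums _+'_ (y +' x) xs

-- S is a finite subset of A \ {0}: duplicate-free list of nonzero elements
IsSubsetNZ : {G : Set a} → G → List G → Set a
IsSubsetNZ 0G S = Unique S × All (_≢ 0G) S

NonZeroSum : {G : Set a} → (G → G → G) → G → List G → Set a
NonZeroSum _+'_ 0G S = foldr _+'_ 0G S ≢ 0G

Sequenceable : {G : Set a} → (G → G → G) → G → List G → Set a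
Sequenceable _+'_ 0G S =
  ∃ λ xs → (xs ↭ S) ×
    (let ys = partialSums _+'_ 0G xs in
     (i j : Fin (length ys)) → toℕ i < toℕ j →
       lookup ys i ≡ lookup ys j → (toℕ i ≡ 0) × (toℕ j ≡ length S))

HasType : {X : Set} {t : ℕ} → List (X × Fin (suc t)) → (Fin (suc t) → ℕ) → Set
HasType S lam = ∀ i → length (filter (λ s → proj₂ s Fin.≟ i) S) ≡ lam i

-- Z_{suc n} as Fin (suc n) with addition mod (suc n)

_+ₘ_ : {n : ℕ} → Fin (suc n) → Fin (suc n) → Fin (suc n)
_+ₘ_ {n} x y = fromℕ< (m%n<n (toℕ x + toℕ y) (suc n))

module _ {t : ℕ} (H : FinAbGroup t) where
  open FinAbGroup H

  addZp×H : {n : ℕ} → (Fin (suc n) × Fin (suc t)) → (Fin (suc n) × Fin (suc t))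
          → (Fin (suc n) × Fin (suc t))
  addZp×H (a₁ , h₁) (a₂ , h₂) = (a₁ +ₘ a₂) , (h₁ ∙ h₂)

  zeroZp×H : {n : ℕ} → Fin (suc n) × Fin (suc t)
  zeroZp×H = Fin.zero , Fin.zero

  addZ×H : (ℤ × Fin (suc t)) → (ℤ × Fin (suc t)) → (ℤ × Fin (suc t))
  addZ×H (a₁ , h₁) (a₂ , h₂) = (a₁ ℤ.+ a₂) , (h₁ ∙ h₂)

  zeroZ×H : ℤ × Fin (suc t)
  zeroZ×H = ℤ.0ℤ , Fin.zero

{-# OPTIONS --safe #-}
-- Put B = Σ |aᵢ| over the elements (aᵢ, hᵢ) of S and reduce first coordinates modulo p > 2B.
-- This is a homomorphism ℤ × H → ℤₚ × H, injective on elements with |a| ≤ B; these include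
-- 0, every element of S and the sum of S. So the image of S is again a non-zero sum subset of
-- type λ, and an ordering of it with distinct partial sums pulls back to an ordering of S,
-- because equal partial sums in ℤ × H would map to equal partial sums in ℤₚ × H.
module Submission where

open import Defs
open import Data.Nat using (ℕ; suc; _≤_)
open import Data.Nat.Primality using (Prime)
open import Data.Integer using (ℤ)
open import Data.Fin using (Fin)
open import Data.Product using (∃; _×_)
open import Data.List using (List)

open import Level using (Level)
open import Function using (_∘_)
open import Data.Bool using (true; false)
open import Data.Nat as ℕ using (zero; _<_)
import Data.Nat.Properties as ℕ
open import Data.Nat.Divisibility using (>⇒∤)
open import Data.Nat.ListAction using (sum)
open import Data.Integer as ℤ using (+_; ∣_∣; _-_; 0ℤ)
open import Data.Integer.Properties
  using (∣i∣≡0⇒i≡0; i-j≡0⇒i≡j; +-injective; +-inverseʳ; pos-+; m-n≡m⊖n; ∣m⊝n∣≤m⊔n; ∣i-j∣≤∣i∣+∣j∣; ∣i+j∣≤∣i∣+∣j∣)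
open import Data.Integer.DivMod using (_%ℕ_; _/ℕ_; n%ℕd<d; a≡a%ℕn+[a/ℕn]*n)
open import Data.Integer.Divisibility.Signed using (_∣_; divides; ∣⇒∣ᵤ; ∣m∣n⇒∣m+n; ∣m∣n⇒∣m-n)
open import Data.Integer.Tactic.RingSolver using (solve-∀)
open import Data.Fin as Fin using (toℕ; fromℕ<)
open import Data.Fin.Properties using (toℕ-fromℕ<; toℕ-injective; toℕ-cast; toℕ<n)
open import Data.Product as Product using (_,_; proj₁; proj₂; map₁)
open import Data.List using ([]; _∷_; map; foldr; filter; length; lookup)
open import Data.List.Properties using (length-map)
open import Data.List.Relation.Unary.All as All using (All; []; _∷_)
open import Data.List.Relation.Unary.All.Properties using (map⁺; map⁻)
open import Data.List.Relation.Unary.Unique.Propositional using (Unique)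
open import Data.List.Relation.Unary.AllPairs using ([]; _∷_)
open import Data.List.Relation.Binary.Permutation.Propositional using (↭-sym)
open import Data.List.Relation.Binary.Permutation.Propositional.Properties using (↭-map-inv)
open import Relation.Nullary using (Dec; does; contradiction)
open import Relation.Unary using (Pred; Decidable)
open import Relation.Binary.PropositionalEquality

private variable
  a b p : Level
  A B : Set a

lookup-map : (f : A → B) (xs : List A) (i : Fin (length xs)) →
  lookup (map f xs) (Fin.cast (sym (length-map f xs)) i) ≡ f (lookup xs i)
lookup-map f (x ∷ xs) Fin.zero    = refl
lookup-map f (x ∷ xs) (Fin.suc i) = lookup-map f xs i

filter-map : {P : Pred B p} (P? : Decidable P) (f : A → B) (xs : List A) →
  filter P? (map f xs) ≡ map f (filter (P? ∘ f) xs)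
filter-map P? f []       = refl
filter-map P? f (x ∷ xs) with does (P? (f x))
... | true  = cong (f x ∷_) (filter-map P? f xs)
... | false = filter-map P? f xs

All-≤-sum : (ns : List ℕ) → All (_≤ sum ns) ns
All-≤-sum []       = []
All-≤-sum (n ∷ ns) =
  ℕ.m≤m+n n (sum ns) ∷ All.map (λ m≤Σ → ℕ.≤-trans m≤Σ (ℕ.m≤n+m (sum ns) n)) (All-≤-sum ns)

∣sum∣≤sum∣∣ : (is : List ℤ) → ∣ foldr ℤ._+_ 0ℤ is ∣ ≤ sum (map ∣_∣ is)
∣sum∣≤sum∣∣ []       = ℕ.z≤n
∣sum∣≤sum∣∣ (i ∷ is) =
  ℕ.≤-trans (∣i+j∣≤∣i∣+∣j∣ i _) (ℕ.+-monoʳ-≤ ∣ i ∣ (∣sum∣≤sum∣∣ is))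

DistinctExceptEnds : List A → ℕ → Set _
DistinctExceptEnds ys k = (i j : Fin (length ys)) → toℕ i < toℕ j →
  lookup ys i ≡ lookup ys j → (toℕ i ≡ 0) × (toℕ j ≡ k)

DistinctExceptEnds-map⁻ : (f : A → B) (ys : List A) (k : ℕ) →
  DistinctExceptEnds (map f ys) k → DistinctExceptEnds ys k
DistinctExceptEnds-map⁻ f ys k distinct i j i<j yᵢ≡yⱼ =
  Product.map (trans (sym (toℕ-cast _ i))) (trans (sym (toℕ-cast _ j)))
    (distinct (cast i) (cast j) (subst₂ _<_ (sym (toℕ-cast _ i)) (sym (toℕ-cast _ j)) i<j)
      (trans (lookup-map f ys i) (trans (cong f yᵢ≡yⱼ) (sym (lookup-map f ys j)))))
  where
  cast : Fin (length ys) → Fin (length (map f ys))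
  cast = Fin.cast (sym (length-map f ys))

InjectiveOn : Pred A p → (A → B) → Set _
InjectiveOn P f = ∀ {x y} → P x → P y → f x ≡ f y → x ≡ y

Unique-map⁺ : {P : Pred A p} {f : A → B} → InjectiveOn P f →
  {xs : List A} → All P xs → Unique xs → Unique (map f xs)
Unique-map⁺ {P = P} {f} injective = go
  where
  go : ∀ {xs} → All P xs → Unique xs → Unique (map f xs)
  go []           []           = []
  go (px ∷ pxs) (x∉xs ∷ unique) =
    map⁺ (All.zipWith (λ (py , x≢y) fx≡fy → x≢y (injective px py fx≡fy)) (pxs , x∉xs))
    ∷ go pxs unique

module Homomorphism
  {A : Set a} {B : Set b} (_+ᴬ_ : A → A → A) (0ᴬ : A) (_+ᴮ_ : B → B → B) (0ᴮ : B)
  (f : A → B) (f-+ : ∀ x y → f (x +ᴬ y) ≡ f x +ᴮ f y) (f-0 : f 0ᴬ ≡ 0ᴮ)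
  where

  foldr-map : (xs : List A) → f (foldr _+ᴬ_ 0ᴬ xs) ≡ foldr _+ᴮ_ 0ᴮ (map f xs)
  foldr-map []       = f-0
  foldr-map (x ∷ xs) = trans (f-+ x _) (cong (f x +ᴮ_) (foldr-map xs))

  partialSums-map : (y : A) (xs : List A) →
    map f (partialSums _+ᴬ_ y xs) ≡ partialSums _+ᴮ_ (f y) (map f xs)
  partialSums-map y []       = refl
  partialSums-map y (x ∷ xs) = cong (f y ∷_) (begin
    map f (partialSums _+ᴬ_ (y +ᴬ x) xs)        ≡⟨ partialSums-map (y +ᴬ x) xs ⟩
    partialSums _+ᴮ_ (f (y +ᴬ x)) (map f xs)   ≡⟨ cong (λ z → partialSums _+ᴮ_ z (map f xs)) (f-+ y x) ⟩
    partialSums _+ᴮ_ (f y +ᴮ f x) (map f xs)   ∎)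
    where open ≡-Reasoning

  -- No injectivity is needed: a collision of partial sums in A maps to a collision in B.
  Sequenceable-map⁻ : (S : List A) → Sequenceable _+ᴮ_ 0ᴮ (map f S) → Sequenceable _+ᴬ_ 0ᴬ S
  Sequenceable-map⁻ S (ys , ys↭fS , distinct)
    with xs , refl , S↭xs ← ↭-map-inv f (↭-sym ys↭fS) =
    xs , ↭-sym S↭xs ,
    DistinctExceptEnds-map⁻ f (partialSums _+ᴬ_ 0ᴬ xs) (length S)
      (subst₂ DistinctExceptEnds (sym partialSums-f) (length-map f S) distinct)
    where
    partialSums-f : map f (partialSums _+ᴬ_ 0ᴬ xs) ≡ partialSums _+ᴮ_ 0ᴮ (map f xs)
    partialSums-f = trans (partialSums-map 0ᴬ xs) (cong (λ z → partialSums _+ᴮ_ z (map f xs)) f-0)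

  module _ {P : Pred A p} (injective : InjectiveOn P f) (P0 : P 0ᴬ) where

    IsSubsetNZ-map⁺ : {S : List A} → All P S → IsSubsetNZ 0ᴬ S → IsSubsetNZ 0ᴮ (map f S)
    IsSubsetNZ-map⁺ PS (unique , nonzero) =
      Unique-map⁺ injective PS unique ,
      map⁺ (All.zipWith (λ (Px , x≢0) fx≡0 → x≢0 (injective Px P0 (trans fx≡0 (sym f-0))))
                        (PS , nonzero))

    NonZeroSum-map⁺ : {S : List A} → P (foldr _+ᴬ_ 0ᴬ S) →
      NonZeroSum _+ᴬ_ 0ᴬ S → NonZeroSum _+ᴮ_ 0ᴮ (map f S)
    NonZeroSum-map⁺ {S} PΣ Σ≢0 fΣ≡0 =
      Σ≢0 (injective PΣ P0 (trans (foldr-map S) (trans fΣ≡0 (sym f-0))))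

k∣i∧∣i∣<k⇒i≡0 : ∀ {k} (i : ℤ) → + k ∣ i → ∣ i ∣ < k → i ≡ 0ℤ
k∣i∧∣i∣<k⇒i≡0 i k∣i ∣i∣<k with ∣ i ∣ in ∣i∣≡ | ∣⇒∣ᵤ k∣i
... | zero  | _     = ∣i∣≡0⇒i≡0 ∣i∣≡
... | suc _ | k∣∣i∣ = contradiction k∣∣i∣ (>⇒∤ ∣i∣<k)

module Reduction (n : ℕ) where

  reduce : ℤ → Fin (suc n)
  reduce i = fromℕ< (n%ℕd<d i (suc n))

  residue : ℤ → ℤ
  residue i = + toℕ (reduce i)

  p∣i-residue : ∀ i → + suc n ∣ i - residue i
  p∣i-residue i = divides q (begin
    i - residue i                 ≡⟨ cong (λ r → i - + r) (toℕ-fromℕ< _) ⟩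
    i - r                         ≡⟨ cong (_- r) (a≡a%ℕn+[a/ℕn]*n i (suc n)) ⟩
    r ℤ.+ q ℤ.* + suc n - r       ≡⟨ cancel r q (+ suc n) ⟩
    q ℤ.* + suc n                 ∎)
    where
    open ≡-Reasoning
    r = + (i %ℕ suc n)
    q = i /ℕ suc n
    cancel : ∀ r q p → r ℤ.+ q ℤ.* p - r ≡ q ℤ.* p
    cancel = solve-∀

  ∣residue-residue∣<p : ∀ i j → ∣ residue i - residue j ∣ < suc n
  ∣residue-residue∣<p i j = begin-strict
    ∣ + r - + s ∣  ≡⟨ cong ∣_∣ (m-n≡m⊖n r s) ⟩
    ∣ r ℤ.⊖ s ∣    ≤⟨ ∣m⊝n∣≤m⊔n r s ⟩
    r ℕ.⊔ s        <⟨ ℕ.⊔-lub (toℕ<n (reduce i)) (toℕ<n (reduce j)) ⟩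
    suc n          ∎
    where
    open ℕ.≤-Reasoning
    r = toℕ (reduce i)
    s = toℕ (reduce j)

  difference-residues : ∀ i j → i - j ≡ (i - residue i) - (j - residue j) ℤ.+ (residue i - residue j)
  difference-residues i j = identity i j (residue i) (residue j)
    where
    identity : ∀ i j r s → i - j ≡ (i - r) - (j - s) ℤ.+ (r - s)
    identity = solve-∀

  residue-difference : ∀ i j → residue i - residue j ≡ (i - j) - (i - residue i) ℤ.+ (j - residue j)
  residue-difference i j = identity i j (residue i) (residue j)
    where
    identity : ∀ i j r s → r - s ≡ (i - j) - (i - r) ℤ.+ (j - s)
    identity = solve-∀

  reduce-≡⇒p∣i-j : ∀ {i j} → reduce i ≡ reduce j → + suc n ∣ i - j
  reduce-≡⇒p∣i-j {i} {j} eq = subst (+ suc n ∣_) (sym (difference-residues i j))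
    (∣m∣n⇒∣m+n (∣m∣n⇒∣m-n (p∣i-residue i) (p∣i-residue j)) p∣0)
    where
    p∣0 : + suc n ∣ residue i - residue j
    p∣0 rewrite eq = divides 0ℤ (+-inverseʳ (residue j))

  p∣i-j⇒reduce-≡ : ∀ {i j} → + suc n ∣ i - j → reduce i ≡ reduce j
  p∣i-j⇒reduce-≡ {i} {j} p∣i-j =
    toℕ-injective (+-injective (i-j≡0⇒i≡j _ _
      (k∣i∧∣i∣<k⇒i≡0 _ p∣r-s (∣residue-residue∣<p i j))))
    where
    p∣r-s : + suc n ∣ residue i - residue j
    p∣r-s = subst (+ suc n ∣_) (sym (residue-difference i j))
      (∣m∣n⇒∣m+n (∣m∣n⇒∣m-n p∣i-j (p∣i-residue i)) (p∣i-residue j))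

  reduce-+ : ∀ i j → reduce (i ℤ.+ j) ≡ reduce i +ₘ reduce j
  reduce-+ i j = p∣i-j⇒reduce-≡ {i ℤ.+ j} {+ (r ℕ.+ s)}
    (subst (+ suc n ∣_) (sym split) (∣m∣n⇒∣m+n (p∣i-residue i) (p∣i-residue j)))
    where
    r = toℕ (reduce i)
    s = toℕ (reduce j)
    identity : ∀ i j r s → i ℤ.+ j - (r ℤ.+ s) ≡ (i - r) ℤ.+ (j - s)
    identity = solve-∀
    split : i ℤ.+ j - + (r ℕ.+ s) ≡ (i - + r) ℤ.+ (j - + s)
    split = trans (cong (i ℤ.+ j -_) (pos-+ r s)) (identity i j (+ r) (+ s))

  reduce-injective : ∀ {i j} → ∣ i ∣ ℕ.+ ∣ j ∣ < suc n → reduce i ≡ reduce j → i ≡ j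
  reduce-injective {i} {j} small eq = i-j≡0⇒i≡j i j
    (k∣i∧∣i∣<k⇒i≡0 _ (reduce-≡⇒p∣i-j {i} {j} eq) (ℕ.≤-<-trans (∣i-j∣≤∣i∣+∣j∣ i j) small))

sumAbs : {X : Set} → List (ℤ × X) → ℕ
sumAbs S = sum (map ∣_∣ (map proj₁ S))

AllSequenceable : {X : Set} {t : ℕ} → (X × Fin (suc t) → X × Fin (suc t) → X × Fin (suc t)) →
  X × Fin (suc t) → (Fin (suc t) → ℕ) → Set
AllSequenceable _+_ 0# lam =
  (S : List _) → IsSubsetNZ 0# S → NonZeroSum _+_ 0# S → HasType S lam → Sequenceable _+_ 0# S

module _ {t : ℕ} (H : FinAbGroup t) where

  module Proj₁ = Homomorphism (addZ×H H) (zeroZ×H H) ℤ._+_ 0ℤ proj₁ (λ _ _ → refl) refl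

  ∣sum∣≤sumAbs : (S : List (ℤ × Fin (suc t))) → ∣ proj₁ (foldr (addZ×H H) (zeroZ×H H) S) ∣ ≤ sumAbs S
  ∣sum∣≤sumAbs S =
    subst (λ i → ∣ i ∣ ≤ sumAbs S) (sym (Proj₁.foldr-map S)) (∣sum∣≤sum∣∣ (map proj₁ S))

  module _ (n : ℕ) where
    open Reduction n

    reduce₁ : ℤ × Fin (suc t) → Fin (suc n) × Fin (suc t)
    reduce₁ = map₁ reduce

    reduce₁-+ : ∀ x y → reduce₁ (addZ×H H x y) ≡ addZp×H H (reduce₁ x) (reduce₁ y)
    reduce₁-+ x y = cong (_, _) (reduce-+ (proj₁ x) (proj₁ y))

    open Homomorphism (addZ×H H) (zeroZ×H H) (addZp×H H) (zeroZp×H H) reduce₁ reduce₁-+ refl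

    HasType-reduce₁ : ∀ {lam} (S : List (ℤ × Fin (suc t))) → HasType S lam → HasType (map reduce₁ S) lam
    HasType-reduce₁ {lam} S S-type i = begin
      length (filter inᵢ? (map reduce₁ S))  ≡⟨ cong length (filter-map inᵢ? reduce₁ S) ⟩
      length (map reduce₁ (filter inᵢ? S))  ≡⟨ length-map reduce₁ (filter inᵢ? S) ⟩
      length (filter inᵢ? S)                ≡⟨ S-type i ⟩
      lam i                                 ∎
      where
      open ≡-Reasoning
      inᵢ? : {X : Set} (s : X × Fin (suc t)) → Dec (proj₂ s ≡ i)
      inᵢ? s = proj₂ s Fin.≟ i

    AllSequenceable-reduce⁻ : ∀ {lam} → AllSequenceable (addZp×H H {n}) (zeroZp×H H) lam →
      (S : List (ℤ × Fin (suc t))) → sumAbs S ℕ.+ sumAbs S < suc n →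
      IsSubsetNZ (zeroZ×H H) S → NonZeroSum (addZ×H H) (zeroZ×H H) S → HasType S lam →
      Sequenceable (addZ×H H) (zeroZ×H H) S
    AllSequenceable-reduce⁻ sequenceableₙ S 2B<p S-subset S-sum S-type =
      Sequenceable-map⁻ S (sequenceableₙ (map reduce₁ S)
        (IsSubsetNZ-map⁺ injective ℕ.z≤n small-elements S-subset)
        (NonZeroSum-map⁺ injective ℕ.z≤n {S} (∣sum∣≤sumAbs S) S-sum)
        (HasType-reduce₁ S S-type))
      where
      Small : Pred (ℤ × Fin (suc t)) _
      Small s = ∣ proj₁ s ∣ ≤ sumAbs S

      small-elements : All Small S
      small-elements = map⁻ (map⁻ (All-≤-sum (map ∣_∣ (map proj₁ S))))

      injective : InjectiveOn Small reduce₁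
      injective small-x small-y eq = cong₂ _,_
        (reduce-injective (ℕ.≤-<-trans (ℕ.+-mono-≤ small-x small-y) 2B<p) (cong proj₁ eq))
        (cong proj₂ eq)

proposition4p2 : (t : ℕ) (H : FinAbGroup t) (lam : Fin (suc t) → ℕ) →
    ((m : ℕ) → ∃ λ n → (m ≤ n) × Prime (suc n) ×
      ((S : List (Fin (suc n) × Fin (suc t))) →
        IsSubsetNZ (zeroZp×H H) S → NonZeroSum (addZp×H H) (zeroZp×H H) S →
        HasType S lam → Sequenceable (addZp×H H) (zeroZp×H H) S)) →
    (S : List (ℤ × Fin (suc t))) →
      IsSubsetNZ (zeroZ×H H) S → NonZeroSum (addZ×H H) (zeroZ×H H) S →
      HasType S lam → Sequenceable (addZ×H H) (zeroZ×H H) S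
proposition4p2 t H lam sequenceable S
  -- Any modulus above 2 Σ|aᵢ| works.
  with n , 2B≤n , _ , sequenceableₙ ← sequenceable (sumAbs S ℕ.+ sumAbs S) =
  AllSequenceable-reduce⁻ H n sequenceableₙ S (ℕ.s≤s 2B≤n)
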